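{- For all $n\geq1$, the number of Dyck paths with air pockets (of any length) having exactly $n$ up-steps $U$ is the Catalan number $\frac{1}{n+1}\binom{2n}{n}$.
   Context: A Dyck path with air pockets is a non-empty lattice path in the first quadrant of $\mathbb{Z}^2$ starting at the origin, ending on the $x$-axis, consisting of up-steps $U=(1,1)$ and down-steps $D_k=(1,-k)$, $k\geq1$, where no two down-steps are consecutive. -}

module Defs where

open import Data.Nat using (ℕ; zero; suc; _+_; _*_; _∸_; _≤ᵇ_; _≡ᵇ_; _/_)
open import Data.Nat.Combinatorics using (_C_)
open import Data.Bool using (Bool; true; false; _∧_; T)
open import Data.List using (List; []; _∷_)
open import Data.Product using (Σ; _×_)
open import Relation.Binary.PropositionalEquality using (_≡_)

-- Steps: U = (1,1) and D k = (1, -(k+1)), i.e. down-steps D_j with j = k+1 ≥ 1.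
data Step : Set where
  U : Step
  D : (k : ℕ) → Step

-- valid h afterDown s : the path s, started at height h (afterDown = whether the
-- previous step was a down-step), stays weakly above the x-axis, never has two
-- consecutive down-steps, and ends on the x-axis.
valid : ℕ → Bool → List Step → Bool
valid h _     []           = h ≡ᵇ 0
valid h _     (U ∷ s)      = valid (suc h) false s
valid h true  (D k ∷ s)    = false
valid h false (D k ∷ s)    = (suc k ≤ᵇ h) ∧ valid (h ∸ suc k) true s

nonEmpty : List Step → Bool
nonEmpty []      = false
nonEmpty (_ ∷ _) = true

IsAirPocketDyck : List Step → Set
IsAirPocketDyck p = T (nonEmpty p ∧ valid 0 false p)

countU : List Step → ℕ
countU []      = 0
countU (U ∷ s) = suc (countU s)
countU (D _ ∷ s) = countU s

AirPocketDyck : ℕ → Set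
AirPocketDyck n = Σ (List Step) (λ p → IsAirPocketDyck p × countU p ≡ n)

-- Catalan number  (1/(n+1)) * binom(2n, n)  (the division is exact)
catalan : ℕ → ℕ
catalan n = ((2 * n) C n) / suc n

-- A path from height h + 1 either begins with an up-step, or it begins with a down-step D_j;
-- lowering that step to D_(j-1), or deleting it when j = 1, is a bijection onto all paths
-- from height h.  Hence the number of paths from height h with r up-steps obeys the ballot
-- recursion, whose solution is C(h + 2r, r) − C(h + 2r, h + r + 1); at h = 0 this is the
-- Catalan number, by the absorption identity for binomial coefficients.
module Submission where

open import Defs
open import Data.Bool using (true; false; T)
open import Data.Empty.Polymorphic using (⊥)
open import Data.Fin as Fin using (Fin)
open import Data.Fin.Properties using (+↔⊎)
open import Data.List using (List; []; _∷_)
open import Data.Nat using (ℕ; zero; suc; _+_; _*_; _/_; _≥_; z<s)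
open import Data.Nat.Combinatorics
  using (_C_; nCk+nC[k+1]≡[n+1]C[k+1]; nC1≡n; k>n⇒nCk≡0)
open import Data.Nat.DivMod using (m*n/n≡m)
open import Data.Nat.Properties
  using (≡-irrelevant; suc-injective; +-suc; n<1+n; *-zeroʳ; *-comm; +-cancelʳ-≡)
open import Data.Nat.Tactic.RingSolver using (solve-∀)
open import Data.Product using (Σ; _×_; _,_)
open import Data.Sum using (_⊎_; inj₁; inj₂)
open import Data.Sum.Algebra using (⊎-identityˡ)
open import Data.Sum.Function.Propositional using (_⊎-cong_)
open import Function.Bundles using (_↔_; mk↔ₛ′)
open import Function.Properties.Inverse using (↔-trans; ↔-sym)
open import Level using (0ℓ)
open import Relation.Binary.PropositionalEquality
  using (_≡_; refl; sym; trans; cong; cong₂; subst₂; module ≡-Reasoning)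
open ≡-Reasoning

pascal : ∀ n k → suc n C suc k ≡ n C k + n C suc k
pascal n k = sym (nCk+nC[k+1]≡[n+1]C[k+1] n k)

0C[1+k]≡0 : ∀ k → 0 C suc k ≡ 0
0C[1+k]≡0 k = k>n⇒nCk≡0 (z<s {k})

-- Stated without subtraction: (k + 1) C(n, k + 1) = (n − k) C(n, k).
absorption : ∀ n k → suc k * (n C suc k) + k * (n C k) ≡ n * (n C k)
absorption zero zero = refl
absorption zero (suc k) rewrite 0C[1+k]≡0 (suc k) | 0C[1+k]≡0 k =
  cong₂ _+_ (*-zeroʳ (suc (suc k))) (*-zeroʳ (suc k))
absorption (suc n) zero rewrite nC1≡n (suc n) = units (suc n)
  where
  units : ∀ m → 1 * m + 0 ≡ m * 1
  units = solve-∀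
absorption (suc n) (suc k) = begin
  suc (suc k) * (suc n C suc (suc k)) + suc k * (suc n C suc k)
    ≡⟨ cong₂ (λ x y → suc (suc k) * x + suc k * y) (pascal n (suc k)) (pascal n k) ⟩
  suc (suc k) * (b₁ + b₂) + suc k * (b₀ + b₁)
    ≡⟨ regroup k b₀ b₁ b₂ ⟩
  (suc (suc k) * b₂ + suc k * b₁) + (suc k * b₁ + k * b₀) + b₁ + b₀
    ≡⟨ cong (λ x → x + b₁ + b₀) (cong₂ _+_ (absorption n (suc k)) (absorption n k)) ⟩
  n * b₁ + n * b₀ + b₁ + b₀
    ≡⟨ collect n b₀ b₁ ⟩
  suc n * (b₀ + b₁)
    ≡⟨ cong (suc n *_) (pascal n k) ⟨
  suc n * (suc n C suc k)
    ∎
  where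
  b₀ = n C k
  b₁ = n C suc k
  b₂ = n C suc (suc k)
  regroup : ∀ k x y z → suc (suc k) * (y + z) + suc k * (x + y)
          ≡ (suc (suc k) * z + suc k * y) + (suc k * y + k * x) + y + x
  regroup = solve-∀
  collect : ∀ n x y → n * y + n * x + y + x ≡ suc n * (x + y)
  collect = solve-∀

PathToAxis : ℕ → ℕ → Set
PathToAxis h r = Σ (List Step) λ s → T (valid h false s) × countU s ≡ r

path-≡ : ∀ {h r s v} {c c′ : countU s ≡ r} → _≡_ {A = PathToAxis h r} (s , v , c) (s , v , c′)
path-≡ {s = s} {v} {c} {c′} = cong (λ c → s , v , c) (≡-irrelevant c c′)

valid-afterDown⇒valid : ∀ h s → T (valid h true s) → T (valid h false s)
valid-afterDown⇒valid h []      v = v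
valid-afterDown⇒valid h (U ∷ s) v = v

UpTail : ℕ → ℕ → Set
UpTail h zero    = ⊥
UpTail h (suc r) = PathToAxis (suc (suc h)) r

firstStep : ∀ h r → PathToAxis (suc h) r → UpTail h r ⊎ PathToAxis h r
firstStep h r       (D zero ∷ s , v , c)    = inj₂ (s , valid-afterDown⇒valid h s v , c)
firstStep h r       (D (suc k) ∷ s , v , c) = inj₂ (D k ∷ s , v , c)
firstStep h (suc r) (U ∷ s , v , c)         = inj₁ (s , v , suc-injective c)

prependStep : ∀ h r → UpTail h r ⊎ PathToAxis h r → PathToAxis (suc h) r
prependStep h r       (inj₂ ([] , v , c))      = D 0 ∷ [] , v , c
prependStep h r       (inj₂ (U ∷ s , v , c))   = D 0 ∷ U ∷ s , v , c
prependStep h r       (inj₂ (D k ∷ s , v , c)) = D (suc k) ∷ s , v , c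
prependStep h (suc r) (inj₁ (s , v , c))       = U ∷ s , v , cong suc c

firstStep∘prependStep : ∀ h r x → firstStep h r (prependStep h r x) ≡ x
firstStep∘prependStep h r       (inj₂ ([] , _ , _))      = refl
firstStep∘prependStep h r       (inj₂ (U ∷ _ , _ , _))   = refl
firstStep∘prependStep h r       (inj₂ (D _ ∷ _ , _ , _)) = refl
firstStep∘prependStep h (suc r) (inj₁ _)                 = cong inj₁ path-≡

prependStep∘firstStep : ∀ h r p → prependStep h r (firstStep h r p) ≡ p
prependStep∘firstStep h r       (D zero ∷ [] , _ , _)    = refl
prependStep∘firstStep h r       (D zero ∷ U ∷ _ , _ , _) = refl
prependStep∘firstStep h r       (D (suc k) ∷ _ , _ , _)  = refl
prependStep∘firstStep h (suc r) (U ∷ _ , _ , _)          = path-≡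

firstStep↔ : ∀ h r → PathToAxis (suc h) r ↔ (UpTail h r ⊎ PathToAxis h r)
firstStep↔ h r = mk↔ₛ′ (firstStep h r) (prependStep h r)
  (firstStep∘prependStep h r) (prependStep∘firstStep h r)

PathToAxis-0-0↔ : PathToAxis 0 0 ↔ Fin 1
PathToAxis-0-0↔ = mk↔ₛ′ (λ _ → Fin.zero) (λ _ → [] , _ , refl)
  (λ { Fin.zero → refl ; (Fin.suc ()) })
  (λ { ([] , _ , _) → path-≡ ; (U ∷ _ , _ , ()) ; (D _ ∷ _ , () , _) })

PathToAxis-0-suc↔ : ∀ r → PathToAxis 0 (suc r) ↔ PathToAxis 1 r
PathToAxis-0-suc↔ r = mk↔ₛ′
  (λ { (U ∷ s , v , c) → s , v , suc-injective c })
  (λ (s , v , c) → U ∷ s , v , cong suc c)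
  (λ _ → path-≡)
  (λ { (U ∷ _ , _ , _) → path-≡ })

ballot : ℕ → ℕ → ℕ
ballot h       zero    = 1
ballot zero    (suc r) = ballot 1 r
ballot (suc h) (suc r) = ballot (suc (suc h)) r + ballot h (suc r)

PathToAxis↔ballot : ∀ h r → PathToAxis h r ↔ Fin (ballot h r)
PathToAxis↔ballot zero    zero    = PathToAxis-0-0↔
PathToAxis↔ballot (suc h) zero    =
  ↔-trans (firstStep↔ h zero) (↔-trans (⊎-identityˡ 0ℓ _) (PathToAxis↔ballot h zero))
PathToAxis↔ballot zero    (suc r) = ↔-trans (PathToAxis-0-suc↔ r) (PathToAxis↔ballot 1 r)
PathToAxis↔ballot (suc h) (suc r) = ↔-trans (firstStep↔ h (suc r))
  (↔-trans (PathToAxis↔ballot (suc (suc h)) r ⊎-cong PathToAxis↔ballot h (suc r)) (↔-sym +↔⊎))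

-- The ballot numbers C(h + 2r, r) − C(h + 2r, h + r + 1), with the subtracted term moved left.
ballot-closed : ∀ h r → ballot h r + (h + r * 2) C suc (h + r) ≡ (h + r * 2) C r
ballot-closed h zero = cong suc (k>n⇒nCk≡0 (n<1+n (h + 0)))
ballot-closed zero (suc r) = begin
  ballot 1 r + suc M C suc (suc r)            ≡⟨ cong (ballot 1 r +_) (pascal M (suc r)) ⟩
  ballot 1 r + (M C suc r + M C suc (suc r))  ≡⟨ +-exchange (ballot 1 r) _ _ ⟩
  (ballot 1 r + M C suc (suc r)) + M C suc r  ≡⟨ cong (_+ M C suc r) (ballot-closed 1 r) ⟩
  M C r + M C suc r                           ≡⟨ pascal M r ⟨
  suc M C suc r                               ∎
  where
  M = suc (r * 2)
  +-exchange : ∀ x y z → x + (y + z) ≡ (x + z) + y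
  +-exchange = solve-∀
ballot-closed (suc h) (suc r) = begin
  (ballot (2 + h) r + ballot h (suc r)) + suc M C suc (suc k)
    ≡⟨ cong (ballot (2 + h) r + ballot h (suc r) +_) (pascal M (suc k)) ⟩
  (ballot (2 + h) r + ballot h (suc r)) + (M C suc k + M C suc (suc k))
    ≡⟨ +-exchange (ballot (2 + h) r) _ _ _ ⟩
  (ballot (2 + h) r + M C suc (suc k)) + (ballot h (suc r) + M C suc k)
    ≡⟨ cong₂ _+_ shifted (ballot-closed h (suc r)) ⟩
  M C r + M C suc r
    ≡⟨ pascal M r ⟨
  suc M C suc r
    ∎
  where
  M = h + suc r * 2
  k = h + suc r
  +-exchange : ∀ a b x y → (a + b) + (x + y) ≡ (a + y) + (b + x)
  +-exchange = solve-∀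
  shifted : ballot (2 + h) r + M C suc (suc k) ≡ M C r
  shifted = subst₂ (λ m j → ballot (2 + h) r + m C suc (suc j) ≡ m C r)
    (sym (trans (+-suc h (suc (r * 2))) (cong suc (+-suc h (r * 2))))) (sym (+-suc h r))
    (ballot-closed (2 + h) r)

absorption-central : ∀ n → suc n * ((n * 2) C suc n) ≡ n * ((n * 2) C n)
absorption-central n = +-cancelʳ-≡ _ _ _ (trans (absorption (n * 2) n) (double n (n * 2 C n)))
  where
  double : ∀ n x → n * 2 * x ≡ n * x + n * x
  double = solve-∀

central-binomial : ∀ n → (n * 2) C n ≡ ballot 0 n * suc n
central-binomial n = +-cancelʳ-≡ _ _ _ (begin
  X + n * X                   ≡⟨ cong (suc n *_) (ballot-closed 0 n) ⟨
  suc n * (B + Y)             ≡⟨ distrib n B Y ⟩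
  B * suc n + suc n * Y       ≡⟨ cong (B * suc n +_) (absorption-central n) ⟩
  B * suc n + n * X           ∎)
  where
  X = (n * 2) C n
  Y = (n * 2) C suc n
  B = ballot 0 n
  distrib : ∀ n x y → suc n * (x + y) ≡ x * suc n + suc n * y
  distrib = solve-∀

catalan≡ballot : ∀ n → catalan n ≡ ballot 0 n
catalan≡ballot n = begin
  ((2 * n) C n) / suc n      ≡⟨ cong (λ m → (m C n) / suc n) (*-comm 2 n) ⟩
  ((n * 2) C n) / suc n      ≡⟨ cong (_/ suc n) (central-binomial n) ⟩
  ballot 0 n * suc n / suc n ≡⟨ m*n/n≡m (ballot 0 n) (suc n) ⟩
  ballot 0 n                 ∎

AirPocketDyck↔PathToAxis : ∀ n → AirPocketDyck (suc n) ↔ PathToAxis 0 (suc n)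
AirPocketDyck↔PathToAxis n = mk↔ₛ′
  (λ { (x ∷ s , v , c) → x ∷ s , v , c })
  (λ { (x ∷ s , v , c) → x ∷ s , v , c })
  (λ { (_ ∷ _ , _ , _) → refl })
  (λ { (_ ∷ _ , _ , _) → refl })

corollary1 : (n : ℕ) → n ≥ 1 → AirPocketDyck n ↔ Fin (catalan n)
corollary1 (suc n) _ rewrite catalan≡ballot (suc n) =
  ↔-trans (AirPocketDyck↔PathToAxis n) (PathToAxis↔ballot 0 (suc n))
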